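{- Let $G$ be a finite simple undirected connected AT-free graph of girth at least $5$. Let $x,y$ be a dominating pair of $G$ with $\mathrm{dist}(x,y)$ equal to the diameter of $G$, and let $P$ be a shortest $x$-$y$ path in $G$. Then every vertex $v\in V(G)\setminus V(P)$ satisfies $|N_G(v)\cap V(P)|=1$.
   Context: $G$ is AT-free if it has no asteroidal triple (independent set of three vertices such that between each pair there is a path avoiding the neighbourhood of the third). A set $S$ is dominating if every vertex outside $S$ is adjacent to a vertex of $S$. A pair of vertices $x,y$ is a dominating pair if the vertex set of every $x$-$y$ path in $G$ is a dominating set. $N_G(v)$ is the set of neighbours of $v$. -}

module Defs where

open import Data.Nat using (ℕ; zero; suc; _+_; _≤_)
open import Data.Fin using (Fin) renaming (_≟_ to _≟ᶠ_)
open import Data.Fin.Properties using () 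
open import Data.List using (List; []; _∷_; length; filter; allFin)
open import Data.List.Relation.Unary.Unique.Propositional using (Unique)
open import Data.List.Membership.Propositional using (_∈_; _∉_)
import Data.List.Membership.DecPropositional as DecMem
open import Data.Product using (Σ; ∃; ∃-syntax; _×_; _,_)
open import Data.Sum using (_⊎_)
open import Relation.Nullary using (¬_; Dec)
open import Relation.Nullary.Decidable using (_×-dec_)
open import Relation.Binary.PropositionalEquality using (_≡_; _≢_)

record Graph : Set₁ where
  field
    n     : ℕ
    Adj   : Fin n → Fin n → Set
    adj?  : (u v : Fin n) → Dec (Adj u v)
    sym   : ∀ {u v} → Adj u v → Adj v u
    irrefl : ∀ {u} → ¬ Adj u u

module _ (G : Graph) where
  open Graph G

  Vertex : Set
  Vertex = Fin n

  data Walk : Vertex → Vertex → Set where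
    [_] : (u : Vertex) → Walk u u
    _∷_ : ∀ {u w v} → Adj u w → Walk w v → Walk u v

  len : ∀ {u v} → Walk u v → ℕ
  len [ u ] = zero
  len (_ ∷ p) = suc (len p)

  verts : ∀ {u v} → Walk u v → List Vertex
  verts [ u ] = u ∷ []
  verts (_∷_ {u} _ p) = u ∷ verts p

  record Path (u v : Vertex) : Set where
    constructor path
    field
      walk     : Walk u v
      distinct : Unique (verts walk)
  open Path public

  Connected : Set
  Connected = ∀ u v → Walk u v

  Dist : Vertex → Vertex → ℕ → Set
  Dist u v d = Σ (Walk u v) (λ w → len w ≡ d) × (∀ (w : Walk u v) → d ≤ len w)

  Diameter : ℕ → Set
  Diameter d = (∃[ u ] ∃[ v ] Dist u v d) × (∀ u v e → Dist u v e → e ≤ d)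

  ShortestPath : ∀ {u v} → Path u v → Set
  ShortestPath {u} {v} P = ∀ (w : Walk u v) → len (walk P) ≤ len w

  -- a cycle of length k ≥ 3 is a path u … v with ≥ 3 vertices plus an edge v u;
  -- girth ≥ 5: every cycle has length ≥ 5
  GirthAtLeast5 : Set
  GirthAtLeast5 = ∀ u v → Adj v u → (P : Path u v) → 2 ≤ len (walk P) → 5 ≤ len (walk P) + 1

  InClosedNbhd : Vertex → Vertex → Set
  InClosedNbhd c w = w ≡ c ⊎ Adj c w

  Avoids : ∀ {u v} → Walk u v → Vertex → Set
  Avoids p c = ∀ w → w ∈ verts p → ¬ InClosedNbhd c w

  Independent3 : Vertex → Vertex → Vertex → Set
  Independent3 a b c = a ≢ b × b ≢ c × a ≢ c × ¬ Adj a b × ¬ Adj b c × ¬ Adj a c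

  AsteroidalTriple : Vertex → Vertex → Vertex → Set
  AsteroidalTriple a b c =
    Independent3 a b c
    × (Σ (Path a b) λ p → Avoids (walk p) c)
    × (Σ (Path b c) λ p → Avoids (walk p) a)
    × (Σ (Path a c) λ p → Avoids (walk p) b)

  ATFree : Set
  ATFree = ∀ a b c → ¬ AsteroidalTriple a b c

  Dominating : (Vertex → Set) → Set
  Dominating S = ∀ w → S w ⊎ (∃[ s ] (S s × Adj w s))

  DominatingPair : Vertex → Vertex → Set
  DominatingPair x y = ∀ (P : Path x y) → Dominating (λ w → w ∈ verts (walk P))

  nbrsOnPath : ∀ {u u'} → Vertex → Path u u' → ℕ
  nbrsOnPath v P =
    length (filter (λ w → adj? v w ×-dec (w DM.∈? verts (walk P))) (allFin n))
    where module DM = DecMem {A = Fin n} _≟ᶠ_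

module Submission where

-- Let v be a vertex off the shortest x–y path P.
--  * At least one neighbour: the vertex set of P is dominating (x,y is a
--    dominating pair) and v ∉ P, so v has a neighbour on P.
--  * At most one neighbour: suppose v is adjacent to the vertex u of P and to a
--    later vertex b.  If b is the successor of u we get a triangle, if b is two
--    steps after u a 4-cycle — both excluded by girth ≥ 5.  If b is three or more
--    steps after u, the detour u–v–b is shorter than the segment of P from u to
--    b, contradicting that P is shortest.  Inducting along P handles any pair.
--  * Exactly one neighbour is then a counting fact: filtering a duplicate-free
--    list by a predicate with exactly one witness in it leaves one element.

open import Defs
open import Data.Nat using (ℕ; suc; _≤_; s≤s; z≤n)
open import Data.Nat.Properties using (≤-trans; ≤-refl; n≤1+n; 1+n≰n)
open import Data.List using (List; []; _∷_; length; filter; allFin)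
open import Data.List.Properties using (filter-none)
open import Data.List.Membership.Propositional using (_∈_; _∉_)
open import Data.List.Membership.Propositional.Properties using (∈-allFin)
open import Data.List.Relation.Unary.Any using (here; there)
open import Data.List.Relation.Unary.All using ([]; _∷_)
import Data.List.Relation.Unary.All as All
open import Data.List.Relation.Unary.AllPairs using ([]; _∷_)
open import Data.List.Relation.Unary.Unique.Propositional using (Unique)
open import Data.List.Relation.Unary.Unique.Propositional.Properties using (allFin⁺)
open import Data.Product using (∃; Σ; _×_; _,_)
open import Data.Sum using (inj₁; inj₂)
open import Data.Empty using (⊥; ⊥-elim)
open import Relation.Nullary using (¬_; yes; no)
open import Level using (0ℓ)
open import Relation.Unary using (Pred; Decidable)
open import Relation.Binary.PropositionalEquality using (_≡_; _≢_; refl; sym; cong; subst)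

filter-length-one : ∀ {A : Set} {P : Pred A 0ℓ} (P? : Decidable P) (xs : List A) →
  Unique xs → (∃ λ x → x ∈ xs × P x) → (∀ a b → P a → P b → a ≡ b) →
  length (filter P? xs) ≡ 1
filter-length-one P? [] _ (_ , () , _) _
filter-length-one {P = P} P? (x ∷ xs) (x∉xs ∷ uniq) (w , w∈ , Pw) atMostOne with P? x
... | yes Px = cong suc (cong length (filter-none P? (All.tabulate noOther)))
  where
  noOther : ∀ {z} → z ∈ xs → ¬ P z
  noOther z∈xs Pz = All.lookup x∉xs z∈xs (sym (atMostOne _ _ Pz Px))
... | no ¬Px with w∈
...   | here refl   = ⊥-elim (¬Px Pw)
...   | there w∈xs  = filter-length-one P? xs uniq (w , w∈xs , Pw) atMostOne

∉⇒≢ : ∀ {A : Set} {v x : A} {xs : List A} → v ∉ xs → x ∈ xs → x ≢ v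
∉⇒≢ v∉xs x∈xs x≡v = v∉xs (subst (_∈ _) x≡v x∈xs)

module _ (G : Graph) where
  open Graph G using (Adj) renaming (sym to adj-sym)

  ShortestWalk : ∀ {u y} → Walk G u y → Set
  ShortestWalk {u} {y} w = ∀ (w' : Walk G u y) → len G w ≤ len G w'

  suffixFrom : ∀ {u y b} (w : Walk G u y) → b ∈ verts G w →
               Σ (Walk G b y) λ s → len G s ≤ len G w
  suffixFrom [ u ]   (here refl) = [ u ] , ≤-refl
  suffixFrom (e ∷ w) (here refl) = e ∷ w , ≤-refl
  suffixFrom (e ∷ w) (there b∈w) with suffixFrom w b∈w
  ... | s , s≤w = s , ≤-trans s≤w (n≤1+n _)

  tail-shortest : ∀ {u t y} (e : Adj u t) (w : Walk G t y) →
                  ShortestWalk (e ∷ w) → ShortestWalk w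
  tail-shortest e w shortest w' with shortest (e ∷ w')
  ... | s≤s w≤w' = w≤w'

  -- If u starts a shortest walk and b lies three or more steps further along,
  -- then u and b have no common neighbour v: u–v–b followed by the rest of the
  -- walk from b would be strictly shorter.
  no-common-neighbour-far : ∀ {u t s r y v b}
    (e₁ : Adj u t) (e₂ : Adj t s) (e₃ : Adj s r) (w : Walk G r y) →
    ShortestWalk (e₁ ∷ e₂ ∷ e₃ ∷ w) → b ∈ verts G w → Adj v u → ¬ Adj v b
  no-common-neighbour-far e₁ e₂ e₃ w shortest b∈w vu vb
    with suffixFrom w b∈w
  ... | rest , rest≤w with shortest (adj-sym vu ∷ vb ∷ rest)
  ... | s≤s (s≤s walk≤detour) = 1+n≰n (≤-trans walk≤detour rest≤w)

  module _ (girth : GirthAtLeast5 G) where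

    no-triangle : ∀ {a b c} → a ≢ b → a ≢ c → b ≢ c →
                  Adj a b → Adj b c → Adj c a → ⊥
    no-triangle a≢b a≢c b≢c ab bc ca
      with girth _ _ ca (path (ab ∷ bc ∷ [ _ ]) ((a≢b ∷ a≢c ∷ []) ∷ (b≢c ∷ []) ∷ [] ∷ []))
                 (s≤s (s≤s z≤n))
    ... | s≤s (s≤s (s≤s ()))

    no-square : ∀ {a b c d} → a ≢ b → a ≢ c → a ≢ d → b ≢ c → b ≢ d → c ≢ d →
                Adj a b → Adj b c → Adj c d → Adj d a → ⊥
    no-square a≢b a≢c a≢d b≢c b≢d c≢d ab bc cd da
      with girth _ _ da
             (path (ab ∷ bc ∷ cd ∷ [ _ ])
                   ((a≢b ∷ a≢c ∷ a≢d ∷ []) ∷ (b≢c ∷ b≢d ∷ []) ∷ (c≢d ∷ []) ∷ [] ∷ []))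
             (s≤s (s≤s z≤n))
    ... | s≤s (s≤s (s≤s (s≤s ())))

    -- If v lies off a shortest path and is adjacent to its first vertex u, then v
    -- has no other neighbour on it: the second vertex would close a triangle,
    -- the third a 4-cycle, and any later one a shortcut.
    only-first-neighbour : ∀ {u t y v} (e : Adj u t) (w : Walk G t y) →
      ShortestWalk (e ∷ w) → Unique (verts G (e ∷ w)) → v ∉ verts G (e ∷ w) →
      Adj v u → ∀ {b} → b ∈ verts G w → ¬ Adj v b
    only-first-neighbour e [ t ] _ ((u≢t ∷ _) ∷ _) v∉ vu (here refl) vt =
      no-triangle u≢t (∉⇒≢ v∉ (here refl)) (∉⇒≢ v∉ (there (here refl)))
        e (adj-sym vt) vu
    only-first-neighbour e (_ ∷ _) _ ((u≢t ∷ _) ∷ _) v∉ vu (here refl) vt =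
      no-triangle u≢t (∉⇒≢ v∉ (here refl)) (∉⇒≢ v∉ (there (here refl)))
        e (adj-sym vt) vu
    only-first-neighbour e (e' ∷ [ s ]) _ ((u≢t ∷ u≢s ∷ _) ∷ (t≢s ∷ _) ∷ _) v∉ vu
                         (there (here refl)) vs =
      no-square u≢t u≢s (∉⇒≢ v∉ (here refl)) t≢s
        (∉⇒≢ v∉ (there (here refl))) (∉⇒≢ v∉ (there (there (here refl))))
        e e' (adj-sym vs) vu
    only-first-neighbour e (e' ∷ _ ∷ _) _ ((u≢t ∷ u≢s ∷ _) ∷ (t≢s ∷ _) ∷ _) v∉ vu
                         (there (here refl)) vs =
      no-square u≢t u≢s (∉⇒≢ v∉ (here refl)) t≢s
        (∉⇒≢ v∉ (there (here refl))) (∉⇒≢ v∉ (there (there (here refl))))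
        e e' (adj-sym vs) vu
    only-first-neighbour e (_ ∷ [ _ ]) _ _ _ _ (there (there ()))
    only-first-neighbour e (e' ∷ e'' ∷ w) shortest _ _ vu (there (there b∈w)) =
      no-common-neighbour-far e e' e'' w shortest b∈w vu

    at-most-one-neighbour : ∀ {u y v} (w : Walk G u y) → ShortestWalk w →
      Unique (verts G w) → v ∉ verts G w →
      ∀ {a b} → a ∈ verts G w → b ∈ verts G w → Adj v a → Adj v b → a ≡ b
    at-most-one-neighbour [ _ ] _ _ _ (here refl) (here refl) _ _ = refl
    at-most-one-neighbour (_ ∷ _) _ _ _ (here refl) (here refl) _ _ = refl
    at-most-one-neighbour (e ∷ w) shortest uniq v∉ (here refl) (there b∈w) va vb =
      ⊥-elim (only-first-neighbour e w shortest uniq v∉ va b∈w vb)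
    at-most-one-neighbour (e ∷ w) shortest uniq v∉ (there a∈w) (here refl) va vb =
      ⊥-elim (only-first-neighbour e w shortest uniq v∉ vb a∈w va)
    at-most-one-neighbour (e ∷ w) shortest (_ ∷ uniq) v∉ (there a∈w) (there b∈w) =
      at-most-one-neighbour w (tail-shortest e w shortest) uniq (λ v∈w → v∉ (there v∈w)) a∈w b∈w

lemma2 : (G : Graph) → Connected G → ATFree G → GirthAtLeast5 G →
    (x y : Vertex G) → DominatingPair G x y →
    (D : ℕ) → Diameter G D → Dist G x y D →
    (P : Path G x y) → ShortestPath G P →
    ∀ v → v ∉ verts G (walk P) → nbrsOnPath G v P ≡ 1
lemma2 G _ _ girth x y dominating _ _ _ P shortest v v∉P with dominating P v
... | inj₁ v∈P = ⊥-elim (v∉P v∈P)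
... | inj₂ (s , s∈P , vs) =
  filter-length-one _ (allFin (Graph.n G)) (allFin⁺ (Graph.n G))
    (s , ∈-allFin s , vs , s∈P)
    (λ a b (va , a∈P) (vb , b∈P) →
       at-most-one-neighbour G girth (walk P) shortest (distinct P) v∉P a∈P b∈P va vb)
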